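{- Let $k$ be a non-negative integer and let $M$ be a simple ternary matroid with no coloops that is $k$-paving. Then $M$ is a circuit (i.e., $E(M)$ is itself a circuit of $M$), or $r(M) \leq 4k+2$.
   Context: A ternary matroid is one representable over $GF(3)$. For a matroid $M$ of rank $r$ and a non-negative integer $k$, an element of $M$ is called $k$-loose if every circuit of $M$ that contains it has size greater than $r-k$; $M$ is $k$-paving if every element of $M$ is $k$-loose. A matroid is simple if it has no loops and no parallel pairs. -}

module Defs where

open import Data.Nat using (ℕ; zero; suc; _+_; _*_; _∸_; _<_; _≤_)
open import Data.Nat.DivMod using (_mod_)
open import Data.Fin using (Fin; toℕ)
open import Data.Fin.Subset using (Subset; _∈_; _∉_; _⊆_; _⊂_; ⁅_⁆; _∪_; ⊤; ∣_∣)
open import Data.Product using (Σ; ∃; _×_; _,_)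
open import Relation.Binary.PropositionalEquality using (_≡_; _≢_)
open import Relation.Nullary using (¬_)

GF3 : Set
GF3 = Fin 3

_+₃_ : GF3 → GF3 → GF3
a +₃ b = (toℕ a + toℕ b) mod 3

_*₃_ : GF3 → GF3 → GF3
a *₃ b = (toℕ a * toℕ b) mod 3

0₃ : GF3
0₃ = Fin.zero where import Data.Fin as Fin

Σ₃ : ∀ {n} → (Fin n → GF3) → GF3
Σ₃ {zero}  f = 0₃
Σ₃ {suc n} f = f Fin.zero +₃ Σ₃ (λ i → f (Fin.suc i)) where import Data.Fin as Fin

-- A matrix over GF(3) with m rows and n columns, given by its columns.
-- The column matroid M[A] has ground set Fin n.
Matrix₃ : ℕ → ℕ → Set
Matrix₃ m n = Fin n → (Fin m → GF3)

module _ {m n : ℕ} (A : Matrix₃ m n) where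

  Dependent : Subset n → Set
  Dependent S = Σ (Fin n → GF3) λ c →
      (∀ i → c i ≢ 0₃ → i ∈ S)
    × (∃ λ i → c i ≢ 0₃)
    × (∀ j → Σ₃ (λ i → c i *₃ A i j) ≡ 0₃)

  Independent : Subset n → Set
  Independent S = ¬ Dependent S

  Circuit : Subset n → Set
  Circuit C = Dependent C × (∀ D → D ⊂ C → Independent D)

  Basis : Subset n → Set
  Basis B = Independent B × (∀ S → B ⊂ S → Dependent S)

  IsRank : ℕ → Set
  IsRank r = (∃ λ S → Independent S × ∣ S ∣ ≡ r)
           × (∀ S → Independent S → ∣ S ∣ ≤ r)

  Loop : Fin n → Set
  Loop e = Circuit ⁅ e ⁆

  Parallel : Fin n → Fin n → Set
  Parallel e f = e ≢ f × Circuit (⁅ e ⁆ ∪ ⁅ f ⁆)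

  Simple : Set
  Simple = (∀ e → ¬ Loop e) × (∀ e f → ¬ Parallel e f)

  Coloop : Fin n → Set
  Coloop e = ∀ B → Basis B → e ∈ B

  NoColoops : Set
  NoColoops = ∀ e → ¬ Coloop e

  Loose : ℕ → ℕ → Fin n → Set
  Loose r k e = ∀ C → Circuit C → e ∈ C → r ∸ k < ∣ C ∣

  Paving : ℕ → ℕ → Set
  Paving r k = ∀ e → Loose r k e

  IsCircuitMatroid : Set
  IsCircuitMatroid = Circuit ⊤

-- Fix a basis B. If two elements e ≠ f lie outside B, let p and q be the GF(3)
-- dependencies of the fundamental circuits of e and f. Then p, q, p + q and p − q
-- are nonzero dependencies, so by k-pavingness each has more than r − k nonzero
-- entries. Coordinatewise over GF(3), wt(x+y) + wt(x−y) + 3 wt(xy) = 2 wt x + 2 wt y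
-- and wt x + wt y ≤ 1 + wt(xy); summing over B ∪ {e, f}, whose size is r + 2, gives
-- 4(r − k + 1) ≤ 3(r + 2), that is r ≤ 4k + 2.
-- If exactly one element e lies outside B, the dependencies of M form a line, so a
-- dependency vanishing at some x forces every dependency to vanish at x, making x a
-- coloop; hence E(M) is a circuit. If B = E(M), every element is a coloop, so r = 0.

module Submission where

open import Defs
open import Data.Nat using (ℕ; zero; suc; _+_; _*_; _∸_; _≤_; _<_; z≤n; s≤s)
open import Data.Sum using (_⊎_; inj₁; inj₂)
open import Data.Nat.Properties
open import Data.Nat.Tactic.RingSolver using (solve-∀)
open import Data.Bool.Base using (Bool; true; false)
open import Data.Empty using (⊥-elim)
open import Data.Fin.Base using (Fin; zero; suc)
open import Data.Fin.Properties using (any?; all?) renaming (_≟_ to _≟ᶠ_)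
open import Data.Fin.Subset using (Subset; _∈_; _∉_; _⊆_; _⊂_; ⁅_⁆; _∪_; ⊤; ∣_∣; inside; outside)
open import Data.Fin.Subset.Properties
  using (_∈?_; _⊂?_; anySubset?; p⊆q⇒∣p∣≤∣q∣; p⊂q⇒∣p∣<∣q∣; p⊆p∪q; x∈p∪q⁻; x∈p∪q⁺; x∈⁅x⁆; x∈⁅y⁆⇒x≡y; ∣⁅x⁆∣≡1; ∈⊤; ⊆⊤)
open import Data.Vec.Base using ([]; _∷_; lookup; tabulate)
open import Data.Vec.Properties using (lookup⇒[]=; []=⇒lookup; lookup∘tabulate)
open import Data.Vec.Functional as Vector using (Vector; head; tail)
open import Data.Product using (∃; ∃₂; _×_; _,_; proj₁)
open import Function using (_∘_; id)
open import Relation.Binary.PropositionalEquality using (_≡_; _≢_; _≗_; refl; sym; trans; cong; cong₂; subst; module ≡-Reasoning)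
open import Relation.Nullary using (¬_; Dec; yes; no)
open import Relation.Nullary.Decidable using (_×-dec_; _→-dec_; ¬?; from-yes; map′; decidable-stable)
open import Relation.Unary using (Decidable)
open import Algebra.Properties.Semiring.Sum +-*-semiring using (sum; sum-cong-≗; ∑-distrib-+; *-distribˡ-sum)

-- 2₃ is −1, so lincomb 1₃ p 2₃ q below is p − q.
1₃ 2₃ : GF3
1₃ = suc zero
2₃ = suc (suc zero)

lincomb-zero : ∀ a b → (a *₃ 0₃) +₃ (b *₃ 0₃) ≡ 0₃
lincomb-zero = from-yes (all? λ a → all? λ b → ((a *₃ 0₃) +₃ (b *₃ 0₃)) ≟ᶠ 0₃)

lincomb-+ : ∀ a b x y x′ y′ →
  ((a *₃ x) +₃ (b *₃ y)) +₃ ((a *₃ x′) +₃ (b *₃ y′)) ≡ (a *₃ (x +₃ x′)) +₃ (b *₃ (y +₃ y′))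
lincomb-+ = from-yes (all? λ a → all? λ b → all? λ x → all? λ y → all? λ x′ → all? λ y′ →
  (((a *₃ x) +₃ (b *₃ y)) +₃ ((a *₃ x′) +₃ (b *₃ y′))) ≟ᶠ ((a *₃ (x +₃ x′)) +₃ (b *₃ (y +₃ y′))))

lincomb-*ʳ : ∀ a b x y z → ((a *₃ x) +₃ (b *₃ y)) *₃ z ≡ (a *₃ (x *₃ z)) +₃ (b *₃ (y *₃ z))
lincomb-*ʳ = from-yes (all? λ a → all? λ b → all? λ x → all? λ y → all? λ z →
  (((a *₃ x) +₃ (b *₃ y)) *₃ z) ≟ᶠ ((a *₃ (x *₃ z)) +₃ (b *₃ (y *₃ z))))

x≢0⇒1·x+b·0≢0 : ∀ b x → x ≢ 0₃ → (1₃ *₃ x) +₃ (b *₃ 0₃) ≢ 0₃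
x≢0⇒1·x+b·0≢0 = from-yes (all? λ b → all? λ x → ¬? (x ≟ᶠ 0₃) →-dec ¬? (((1₃ *₃ x) +₃ (b *₃ 0₃)) ≟ᶠ 0₃))

a·b−b·a≡0 : ∀ a b → (a *₃ b) +₃ ((2₃ *₃ b) *₃ a) ≡ 0₃
a·b−b·a≡0 = from-yes (all? λ a → all? λ b → ((a *₃ b) +₃ ((2₃ *₃ b) *₃ a)) ≟ᶠ 0₃)

b≢0⇒a·0−b·z≡0⇒z≡0 : ∀ a b z → b ≢ 0₃ → (a *₃ 0₃) +₃ ((2₃ *₃ b) *₃ z) ≡ 0₃ → z ≡ 0₃
b≢0⇒a·0−b·z≡0⇒z≡0 = from-yes (all? λ a → all? λ b → all? λ z →
  ¬? (b ≟ᶠ 0₃) →-dec (((a *₃ 0₃) +₃ ((2₃ *₃ b) *₃ z)) ≟ᶠ 0₃ →-dec z ≟ᶠ 0₃))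

Σ₃-cong : ∀ {n} {f g : Fin n → GF3} → f ≗ g → Σ₃ f ≡ Σ₃ g
Σ₃-cong {zero}  f≗g = refl
Σ₃-cong {suc n} f≗g = cong₂ _+₃_ (f≗g zero) (Σ₃-cong (f≗g ∘ suc))

Σ₃-lincomb : ∀ {n} a b (f g : Fin n → GF3) →
  Σ₃ (λ i → (a *₃ f i) +₃ (b *₃ g i)) ≡ (a *₃ Σ₃ f) +₃ (b *₃ Σ₃ g)
Σ₃-lincomb {zero}  a b f g = sym (lincomb-zero a b)
Σ₃-lincomb {suc n} a b f g =
  trans (cong (((a *₃ f zero) +₃ (b *₃ g zero)) +₃_) (Σ₃-lincomb a b (f ∘ suc) (g ∘ suc)))
        (lincomb-+ a b (f zero) (g zero) (Σ₃ (f ∘ suc)) (Σ₃ (g ∘ suc)))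

𝟙 : Bool → ℕ
𝟙 true  = 1
𝟙 false = 0

sum-mono-≤ : ∀ {n} {f g : Vector ℕ n} → (∀ i → f i ≤ g i) → sum f ≤ sum g
sum-mono-≤ {zero}  f≤g = z≤n
sum-mono-≤ {suc n} f≤g = +-mono-≤ (f≤g zero) (sum-mono-≤ (f≤g ∘ suc))

∣p∣≡sum : ∀ {n} (p : Subset n) → ∣ p ∣ ≡ sum (𝟙 ∘ lookup p)
∣p∣≡sum []            = refl
∣p∣≡sum (inside  ∷ p) = cong suc (∣p∣≡sum p)
∣p∣≡sum (outside ∷ p) = ∣p∣≡sum p

∣p∪q∣≤∣p∣+∣q∣ : ∀ {n} (p q : Subset n) → ∣ p ∪ q ∣ ≤ ∣ p ∣ + ∣ q ∣
∣p∪q∣≤∣p∣+∣q∣ []            []            = z≤n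
∣p∪q∣≤∣p∣+∣q∣ (outside ∷ p) (outside ∷ q) = ∣p∪q∣≤∣p∣+∣q∣ p q
∣p∪q∣≤∣p∣+∣q∣ (outside ∷ p) (inside  ∷ q) = ≤-trans (s≤s (∣p∪q∣≤∣p∣+∣q∣ p q)) (≤-reflexive (sym (+-suc ∣ p ∣ ∣ q ∣)))
∣p∪q∣≤∣p∣+∣q∣ (inside  ∷ p) (outside ∷ q) = s≤s (∣p∪q∣≤∣p∣+∣q∣ p q)
∣p∪q∣≤∣p∣+∣q∣ (inside  ∷ p) (inside  ∷ q) = s≤s (≤-trans (∣p∪q∣≤∣p∣+∣q∣ p q) (+-monoʳ-≤ ∣ p ∣ (n≤1+n ∣ q ∣)))

∣p∪⁅x⁆∪⁅y⁆∣≤∣p∣+2 : ∀ {n} (p : Subset n) x y → ∣ (p ∪ ⁅ x ⁆) ∪ ⁅ y ⁆ ∣ ≤ ∣ p ∣ + 2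
∣p∪⁅x⁆∪⁅y⁆∣≤∣p∣+2 p x y = begin
  ∣ (p ∪ ⁅ x ⁆) ∪ ⁅ y ⁆ ∣        ≤⟨ ∣p∪q∣≤∣p∣+∣q∣ (p ∪ ⁅ x ⁆) ⁅ y ⁆ ⟩
  ∣ p ∪ ⁅ x ⁆ ∣ + ∣ ⁅ y ⁆ ∣      ≤⟨ +-monoˡ-≤ ∣ ⁅ y ⁆ ∣ (∣p∪q∣≤∣p∣+∣q∣ p ⁅ x ⁆) ⟩
  ∣ p ∣ + ∣ ⁅ x ⁆ ∣ + ∣ ⁅ y ⁆ ∣  ≡⟨ cong₂ (λ a b → ∣ p ∣ + a + b) (∣⁅x⁆∣≡1 x) (∣⁅x⁆∣≡1 y) ⟩
  ∣ p ∣ + 1 + 1                  ≡⟨ +-assoc ∣ p ∣ 1 1 ⟩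
  ∣ p ∣ + 2                      ∎
  where open ≤-Reasoning

∣p∣≡0 : ∀ {n} (p : Subset n) → ¬ Fin n → ∣ p ∣ ≡ 0
∣p∣≡0 []      _    = refl
∣p∣≡0 (_ ∷ _) ¬fin = ⊥-elim (¬fin zero)

⊂-insert : ∀ {n} {S : Subset n} {e} → e ∉ S → S ⊂ S ∪ ⁅ e ⁆
⊂-insert {S = S} {e} e∉S = p⊆p∪q ⁅ e ⁆ , e , x∈p∪q⁺ (inj₂ (x∈⁅x⁆ e)) , e∉S

∉-insert : ∀ {n} {S : Subset n} {e i} → i ∉ S → i ≢ e → i ∉ S ∪ ⁅ e ⁆
∉-insert {S = S} {e} i∉S i≢e i∈S+e with x∈p∪q⁻ S ⁅ e ⁆ i∈S+e
... | inj₁ i∈S = i∉S i∈S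
... | inj₂ i∈e = i≢e (x∈⁅y⁆⇒x≡y e i∈e)

complement-trichotomy : ∀ {n} (S : Subset n) →
    (∃₂ λ e f → e ∉ S × f ∉ S × e ≢ f)
  ⊎ (∃ λ e → e ∉ S × ∀ i → i ∉ S → i ≡ e)
  ⊎ (∀ i → i ∈ S)
complement-trichotomy S with any? (λ e → any? λ f → ¬? (e ∈? S) ×-dec ¬? (f ∈? S) ×-dec ¬? (e ≟ᶠ f))
... | yes two = inj₁ two
... | no ∄two with any? (λ e → ¬? (e ∈? S))
...   | yes (e , e∉S) =
        inj₂ (inj₁ (e , e∉S , λ i i∉S → decidable-stable (i ≟ᶠ e) λ i≢e → ∄two (i , e , i∉S , e∉S , i≢e)))
...   | no ∄one = inj₂ (inj₂ λ i → decidable-stable (i ∈? S) λ i∉S → ∄one (i , i∉S))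

lincomb : ∀ {n} → GF3 → Vector GF3 n → GF3 → Vector GF3 n → Vector GF3 n
lincomb a p b q i = (a *₃ p i) +₃ (b *₃ q i)

isNonzero : GF3 → Bool
isNonzero zero    = false
isNonzero (suc _) = true

wt : GF3 → ℕ
wt = 𝟙 ∘ isNonzero

weight : ∀ {n} → Vector GF3 n → ℕ
weight c = sum (wt ∘ c)

weight∩ : ∀ {n} → Vector GF3 n → Vector GF3 n → ℕ
weight∩ p q = weight (λ i → p i *₃ q i)

support : ∀ {n} → Vector GF3 n → Subset n
support c = tabulate (isNonzero ∘ c)

SupportedOn : ∀ {n} → Vector GF3 n → Subset n → Set
SupportedOn c S = ∀ i → c i ≢ 0₃ → i ∈ S

supported⇒≡0 : ∀ {n} {c : Vector GF3 n} {S i} → SupportedOn c S → i ∉ S → c i ≡ 0₃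
supported⇒≡0 {c = c} {i = i} c⊆S i∉S = decidable-stable (c i ≟ᶠ 0₃) (i∉S ∘ c⊆S i)

supported-on-support : ∀ {n} (c : Vector GF3 n) → SupportedOn c (support c)
supported-on-support c i ci≢0 = lookup⇒[]= i (support c) (trans (lookup∘tabulate _ i) (≢0⇒isNonzero ci≢0))
  where
  ≢0⇒isNonzero : ∀ {x} → x ≢ 0₃ → isNonzero x ≡ true
  ≢0⇒isNonzero {zero}  x≢0 = ⊥-elim (x≢0 refl)
  ≢0⇒isNonzero {suc _} _   = refl

∣support∣≡weight : ∀ {n} (c : Vector GF3 n) → ∣ support c ∣ ≡ weight c
∣support∣≡weight c = trans (∣p∣≡sum (support c)) (sum-cong-≗ (cong 𝟙 ∘ lookup∘tabulate (isNonzero ∘ c)))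

wt-x±y : ∀ x y →
  wt ((1₃ *₃ x) +₃ (1₃ *₃ y)) + wt ((1₃ *₃ x) +₃ (2₃ *₃ y)) + 3 * wt (x *₃ y) ≡ 2 * wt x + 2 * wt y
wt-x±y = from-yes (all? λ x → all? λ y →
  (wt ((1₃ *₃ x) +₃ (1₃ *₃ y)) + wt ((1₃ *₃ x) +₃ (2₃ *₃ y)) + 3 * wt (x *₃ y)) ≟ (2 * wt x + 2 * wt y))

wt+wt≤1+wt* : ∀ x y → wt x + wt y ≤ 1 + wt (x *₃ y)
wt+wt≤1+wt* = from-yes (all? λ x → all? λ y → (wt x + wt y) ≤? (1 + wt (x *₃ y)))

weight-p±q : ∀ {n} (p q : Vector GF3 n) →
  weight (lincomb 1₃ p 1₃ q) + weight (lincomb 1₃ p 2₃ q) + 3 * weight∩ p q ≡ 2 * weight p + 2 * weight q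
weight-p±q p q = begin
  sum s + sum d + 3 * sum o                    ≡⟨ cong₂ _+_ (sym (∑-distrib-+ s d)) (*-distribˡ-sum 3 o) ⟩
  sum (λ i → s i + d i) + sum (λ i → 3 * o i)  ≡⟨ ∑-distrib-+ (λ i → s i + d i) (λ i → 3 * o i) ⟨
  sum (λ i → s i + d i + 3 * o i)              ≡⟨ sum-cong-≗ (λ i → wt-x±y (p i) (q i)) ⟩
  sum (λ i → 2 * wt (p i) + 2 * wt (q i))      ≡⟨ ∑-distrib-+ (λ i → 2 * wt (p i)) (λ i → 2 * wt (q i)) ⟩
  sum (λ i → 2 * wt (p i)) + sum (λ i → 2 * wt (q i))
    ≡⟨ cong₂ _+_ (*-distribˡ-sum 2 (wt ∘ p)) (*-distribˡ-sum 2 (wt ∘ q)) ⟨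
  2 * weight p + 2 * weight q                  ∎
  where
  open ≡-Reasoning
  s d o : Vector ℕ _
  s = wt ∘ lincomb 1₃ p 1₃ q
  d = wt ∘ lincomb 1₃ p 2₃ q
  o = λ i → wt (p i *₃ q i)

weight+weight≤∣S∣+weight∩ : ∀ {n} {p q : Vector GF3 n} {S} → SupportedOn p S → SupportedOn q S →
  weight p + weight q ≤ ∣ S ∣ + weight∩ p q
weight+weight≤∣S∣+weight∩ {p = p} {q} {S} p⊆S q⊆S = begin
  weight p + weight q                                 ≡⟨ ∑-distrib-+ (wt ∘ p) (wt ∘ q) ⟨
  sum (λ i → wt (p i) + wt (q i))                     ≤⟨ sum-mono-≤ pointwise ⟩
  sum (λ i → 𝟙 (lookup S i) + wt (p i *₃ q i))        ≡⟨ ∑-distrib-+ (𝟙 ∘ lookup S) (λ i → wt (p i *₃ q i)) ⟩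
  sum (𝟙 ∘ lookup S) + weight∩ p q                    ≡⟨ cong (_+ weight∩ p q) (∣p∣≡sum S) ⟨
  ∣ S ∣ + weight∩ p q                                 ∎
  where
  open ≤-Reasoning
  pointwise : ∀ i → wt (p i) + wt (q i) ≤ 𝟙 (lookup S i) + wt (p i *₃ q i)
  pointwise i with i ∈? S
  ... | yes i∈S rewrite []=⇒lookup i∈S = wt+wt≤1+wt* (p i) (q i)
  ... | no  i∉S rewrite supported⇒≡0 p⊆S i∉S | supported⇒≡0 q⊆S i∉S = z≤n

four-weights-bound : ∀ {u N a b s t c} → s + t + 3 * c ≡ 2 * a + 2 * b → a + b ≤ N + c →
  u < s → u < t → u < a → u < b → 4 * suc u ≤ 3 * N
four-weights-bound {u} {N} {a} {b} {s} {t} {c} sum-identity a+b≤N+c u<s u<t u<a u<b =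
  +-cancelʳ-≤ (3 * c) (4 * suc u) (3 * N) (begin
    4 * suc u + 3 * c                           ≡⟨ regroup u c ⟩
    (suc u + suc u + 3 * c) + (suc u + suc u)   ≤⟨ +-mono-≤ (+-monoˡ-≤ (3 * c) (+-mono-≤ u<s u<t)) (+-mono-≤ u<a u<b) ⟩
    (s + t + 3 * c) + (a + b)                   ≡⟨ cong (_+ (a + b)) sum-identity ⟩
    (2 * a + 2 * b) + (a + b)                   ≡⟨ triple a b ⟩
    3 * (a + b)                                 ≤⟨ *-monoʳ-≤ 3 a+b≤N+c ⟩
    3 * (N + c)                                 ≡⟨ *-distribˡ-+ 3 N c ⟩
    3 * N + 3 * c                               ∎)
  where
  open ≤-Reasoning
  regroup : ∀ u c → 4 * suc u + 3 * c ≡ (suc u + suc u + 3 * c) + (suc u + suc u)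
  regroup = solve-∀
  triple : ∀ a b → (2 * a + 2 * b) + (a + b) ≡ 3 * (a + b)
  triple = solve-∀

excess-bound : ∀ u k → 4 * suc u ≤ 3 * (u + k + 2) → u + k ≤ 4 * k + 2
excess-bound u k bound = begin
  u + k           ≤⟨ +-monoˡ-≤ k u≤3k+2 ⟩
  3 * k + 2 + k   ≡⟨ collect k ⟩
  4 * k + 2       ∎
  where
  open ≤-Reasoning
  collect : ∀ k → 3 * k + 2 + k ≡ 4 * k + 2
  collect = solve-∀
  split-left : ∀ u → u + (3 * u + 4) ≡ 4 * suc u
  split-left = solve-∀
  split-right : ∀ u k → 3 * (u + k + 2) ≡ 3 * k + 2 + (3 * u + 4)
  split-right = solve-∀
  u≤3k+2 : u ≤ 3 * k + 2
  u≤3k+2 = +-cancelʳ-≤ (3 * u + 4) u (3 * k + 2) (begin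
    u + (3 * u + 4)          ≡⟨ split-left u ⟩
    4 * suc u                ≤⟨ bound ⟩
    3 * (u + k + 2)          ≡⟨ split-right u k ⟩
    3 * k + 2 + (3 * u + 4)  ∎)

truncated-bound⇒≤ : ∀ r k → 4 * suc (r ∸ k) ≤ 3 * (r + 2) → r ≤ 4 * k + 2
truncated-bound⇒≤ r k bound with ≤-total k r
... | inj₂ r≤k = ≤-trans r≤k (≤-trans (m≤n*m k 4) (m≤m+n (4 * k) 2))
... | inj₁ k≤r = subst (_≤ 4 * k + 2) r∸k+k≡r
      (excess-bound (r ∸ k) k (subst (λ x → 4 * suc (r ∸ k) ≤ 3 * (x + 2)) (sym r∸k+k≡r) bound))
  where
  r∸k+k≡r : r ∸ k + k ≡ r
  r∸k+k≡r = m∸n+n≡m k≤r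

-- P has to respect ≗ because function extensionality is not available.
anyVector? : ∀ {k p} n {P : Vector (Fin k) n → Set p} →
  (∀ {u v} → u ≗ v → P u → P v) → Decidable P → Dec (∃ P)
anyVector? zero    resp P? = map′ (_ ,_) (λ (u , Pu) → resp (λ ()) Pu) (P? (λ ()))
anyVector? (suc n) resp P? =
  map′ (λ (x , u , Pxu) → x Vector.∷ u , Pxu)
       (λ (u , Pu) → head u , tail u , resp (λ { zero → refl ; (suc i) → refl }) Pu)
       (any? λ x → anyVector? n (λ u≗v → resp (λ { zero → refl ; (suc i) → u≗v i })) (P? ∘ (x Vector.∷_)))

module _ {m n : ℕ} (A : Matrix₃ m n) where

  Annihilates : Vector GF3 n → Set
  Annihilates c = ∀ j → Σ₃ (λ i → c i *₃ A i j) ≡ 0₃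

  IsNonzero : Vector GF3 n → Set
  IsNonzero c = ∃ λ i → c i ≢ 0₃

  annihilates-lincomb : ∀ a p b q → Annihilates p → Annihilates q → Annihilates (lincomb a p b q)
  annihilates-lincomb a p b q pA≡0 qA≡0 j = begin
    Σ₃ (λ i → lincomb a p b q i *₃ A i j)                       ≡⟨ Σ₃-cong (λ i → lincomb-*ʳ a b (p i) (q i) (A i j)) ⟩
    Σ₃ (λ i → (a *₃ (p i *₃ A i j)) +₃ (b *₃ (q i *₃ A i j)))   ≡⟨ Σ₃-lincomb a b (λ i → p i *₃ A i j) (λ i → q i *₃ A i j) ⟩
    (a *₃ Σ₃ (λ i → p i *₃ A i j)) +₃ (b *₃ Σ₃ (λ i → q i *₃ A i j))
      ≡⟨ cong₂ (λ x y → (a *₃ x) +₃ (b *₃ y)) (pA≡0 j) (qA≡0 j) ⟩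
    (a *₃ 0₃) +₃ (b *₃ 0₃)                                      ≡⟨ lincomb-zero a b ⟩
    0₃                                                          ∎
    where open ≡-Reasoning

  dependent? : ∀ S → Dec (Dependent A S)
  dependent? S = anyVector? n resp λ c →
    all? (λ i → ¬? (c i ≟ᶠ 0₃) →-dec i ∈? S) ×-dec any? (λ i → ¬? (c i ≟ᶠ 0₃))
      ×-dec all? (λ j → Σ₃ (λ i → c i *₃ A i j) ≟ᶠ 0₃)
    where
    resp : ∀ {u v} → u ≗ v → SupportedOn u S × IsNonzero u × Annihilates u
                           → SupportedOn v S × IsNonzero v × Annihilates v
    resp u≗v (u⊆S , (i , ui≢0) , uA≡0) =
      (λ j vj≢0 → u⊆S j (vj≢0 ∘ trans (sym (u≗v j)))) ,
      (i , ui≢0 ∘ trans (u≗v i)) ,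
      (λ j → trans (Σ₃-cong (λ i → cong (_*₃ A i j) (sym (u≗v i)))) (uA≡0 j))

  circuit⊆ : ∀ {S} → Dependent A S → ∃ λ C → Circuit A C × C ⊆ S
  circuit⊆ {S} = go (suc ∣ S ∣) ≤-refl
    where
    go : ∀ N {S} → ∣ S ∣ < N → Dependent A S → ∃ λ C → Circuit A C × C ⊆ S
    go (suc N) {S} ∣S∣<N depS with anySubset? (λ D → D ⊂? S ×-dec dependent? D)
    ... | yes (D , D⊂S , depD) =
          let C , circC , C⊆D = go N (≤-trans (p⊂q⇒∣p∣<∣q∣ D⊂S) (≤-pred ∣S∣<N)) depD
          in C , circC , proj₁ D⊂S ∘ C⊆D
    ... | no ∄D = S , (depS , λ D D⊂S depD → ∄D (D , D⊂S , depD)) , id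

  paving⇒r∸k<weight : ∀ {r k c} → Paving A r k → IsNonzero c → Annihilates c → r ∸ k < weight c
  paving⇒r∸k<weight {r} {k} {c} paving c≢0 cA≡0
    with circuit⊆ (c , supported-on-support c , c≢0 , cA≡0)
  ... | C , circC@((_ , d⊆C , (j , dj≢0) , _) , _) , C⊆supp = begin-strict
    r ∸ k           <⟨ paving j C circC (d⊆C j dj≢0) ⟩
    ∣ C ∣           ≤⟨ p⊆q⇒∣p∣≤∣q∣ C⊆supp ⟩
    ∣ support c ∣   ≡⟨ ∣support∣≡weight c ⟩
    weight c        ∎
    where open ≤-Reasoning

  basis-of-rank : ∀ {r} → IsRank A r → ∃ λ B → Basis A B × ∣ B ∣ ≡ r
  basis-of-rank ((B , indB , ∣B∣≡r) , rank-max) = B , (indB , maximal) , ∣B∣≡r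
    where
    maximal : ∀ T → B ⊂ T → Dependent A T
    maximal T B⊂T = decidable-stable (dependent? T) λ indT →
      <⇒≱ (subst (_< ∣ T ∣) ∣B∣≡r (p⊂q⇒∣p∣<∣q∣ B⊂T)) (rank-max T indT)

  independent⇒vanishing : ∀ {S c} → Independent A S → Annihilates c →
    (∀ i → i ∉ S → c i ≡ 0₃) → ∀ i → c i ≡ 0₃
  independent⇒vanishing {S} {c} indS cA≡0 c≡0-off-S i =
    decidable-stable (c i ≟ᶠ 0₃) λ ci≢0 → indS (c , c⊆S , (i , ci≢0) , cA≡0)
    where
    c⊆S : SupportedOn c S
    c⊆S j cj≢0 = decidable-stable (j ∈? S) (cj≢0 ∘ c≡0-off-S j)

  fundamental-coefficient≢0 : ∀ {S e c} → Independent A S → SupportedOn c (S ∪ ⁅ e ⁆) →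
    IsNonzero c → Annihilates c → c e ≢ 0₃
  fundamental-coefficient≢0 {S} {e} {c} indS c⊆S+e (i , ci≢0) cA≡0 ce≡0 =
    ci≢0 (independent⇒vanishing indS cA≡0 c≡0-off-S i)
    where
    c≡0-off-S : ∀ j → j ∉ S → c j ≡ 0₃
    c≡0-off-S j j∉S with j ≟ᶠ e
    ... | yes refl = ce≡0
    ... | no  j≢e  = supported⇒≡0 c⊆S+e (∉-insert j∉S j≢e)

  vanishing⇒coloop : ∀ {x} → (∀ c → Annihilates c → c x ≡ 0₃) → Coloop A x
  vanishing⇒coloop {x} c≡0-at-x B (indB , maximal) = decidable-stable (x ∈? B) λ x∉B →
    let c , c⊆B+x , c≢0 , cA≡0 = maximal (B ∪ ⁅ x ⁆) (⊂-insert x∉B)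
    in fundamental-coefficient≢0 indB c⊆B+x c≢0 cA≡0 (c≡0-at-x c cA≡0)

  two-outside-basis⇒rank≤ : ∀ {r k B e f} → Paving A r k → Basis A B → ∣ B ∣ ≡ r →
    e ∉ B → f ∉ B → e ≢ f → r ≤ 4 * k + 2
  two-outside-basis⇒rank≤ {r} {k} {B} {e} {f} paving (indB , maximal) ∣B∣≡r e∉B f∉B e≢f
    with maximal (B ∪ ⁅ e ⁆) (⊂-insert e∉B) | maximal (B ∪ ⁅ f ⁆) (⊂-insert f∉B)
  ... | p , p⊆B+e , p≢0 , pA≡0 | q , q⊆B+f , q≢0 , qA≡0 =
    truncated-bound⇒≤ r k (four-weights-bound {c = weight∩ p q}
      (weight-p±q p q)
      (≤-trans (weight+weight≤∣S∣+weight∩ p⊆S q⊆S) (+-monoˡ-≤ (weight∩ p q) ∣S∣≤r+2))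
      (large (e , combination≢0 1₃) (annihilates-lincomb 1₃ p 1₃ q pA≡0 qA≡0))
      (large (e , combination≢0 2₃) (annihilates-lincomb 1₃ p 2₃ q pA≡0 qA≡0))
      (large p≢0 pA≡0)
      (large q≢0 qA≡0))
    where
    large : ∀ {c} → IsNonzero c → Annihilates c → r ∸ k < weight c
    large = paving⇒r∸k<weight {r} {k} paving
    S : Subset n
    S = (B ∪ ⁅ e ⁆) ∪ ⁅ f ⁆
    p⊆S : SupportedOn p S
    p⊆S i pi≢0 = p⊆p∪q ⁅ f ⁆ (p⊆B+e i pi≢0)
    q⊆S : SupportedOn q S
    q⊆S i qi≢0 with x∈p∪q⁻ B ⁅ f ⁆ (q⊆B+f i qi≢0)
    ... | inj₁ i∈B = p⊆p∪q ⁅ f ⁆ (p⊆p∪q ⁅ e ⁆ i∈B)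
    ... | inj₂ i∈f = x∈p∪q⁺ (inj₂ i∈f)
    ∣S∣≤r+2 : ∣ S ∣ ≤ r + 2
    ∣S∣≤r+2 = subst (λ s → ∣ S ∣ ≤ s + 2) ∣B∣≡r (∣p∪⁅x⁆∪⁅y⁆∣≤∣p∣+2 B e f)
    combination≢0 : ∀ b → lincomb 1₃ p b q e ≢ 0₃
    combination≢0 b rewrite supported⇒≡0 q⊆B+f (∉-insert e∉B e≢f) =
      x≢0⇒1·x+b·0≢0 b (p e) (fundamental-coefficient≢0 indB p⊆B+e p≢0 pA≡0)

  one-outside-basis⇒circuit : ∀ {B e} → NoColoops A → Basis A B → e ∉ B →
    (∀ i → i ∉ B → i ≡ e) → Circuit A ⊤
  one-outside-basis⇒circuit {B} {e} noColoops (indB , maximal) e∉B only-e =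
    maximal ⊤ (⊆⊤ , e , ∈⊤ , e∉B) , proper-subsets-independent
    where
    supported-on-B+e : ∀ c → SupportedOn c (B ∪ ⁅ e ⁆)
    supported-on-B+e c i _ with i ∈? B
    ... | yes i∈B = p⊆p∪q ⁅ e ⁆ i∈B
    ... | no  i∉B = x∈p∪q⁺ (inj₂ (subst (_∈ ⁅ e ⁆) (sym (only-e i i∉B)) (x∈⁅x⁆ e)))
    proper-subsets-independent : ∀ D → D ⊂ ⊤ → Independent A D
    proper-subsets-independent D (_ , x , _ , x∉D) (d , d⊆D , d≢0 , dA≡0) =
      noColoops x (vanishing⇒coloop c≡0-at-x)
      where
      de≢0 : d e ≢ 0₃
      de≢0 = fundamental-coefficient≢0 indB (supported-on-B+e d) d≢0 dA≡0
      c≡0-at-x : ∀ c → Annihilates c → c x ≡ 0₃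
      c≡0-at-x c cA≡0 = b≢0⇒a·0−b·z≡0⇒z≡0 (c e) (d e) (c x) de≢0 hx≡0
        where
        -- h = c(e)·d − d(e)·c vanishes at e, hence everywhere, and h(x) = −d(e)·c(x).
        h = lincomb (c e) d (2₃ *₃ d e) c
        h≡0 : ∀ i → h i ≡ 0₃
        h≡0 = independent⇒vanishing {c = h} indB (annihilates-lincomb (c e) d (2₃ *₃ d e) c dA≡0 cA≡0)
          λ i i∉B → subst (λ j → h j ≡ 0₃) (sym (only-e i i∉B)) (a·b−b·a≡0 (c e) (d e))
        hx≡0 : (c e *₃ 0₃) +₃ ((2₃ *₃ d e) *₃ c x) ≡ 0₃
        hx≡0 = subst (λ y → (c e *₃ y) +₃ ((2₃ *₃ d e) *₃ c x) ≡ 0₃) (supported⇒≡0 d⊆D x∉D) (h≡0 x)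

  independent-ground-set⇒coloop : ∀ {B} → Independent A B → (∀ i → i ∈ B) → ∀ x → Coloop A x
  independent-ground-set⇒coloop indB all∈B x =
    vanishing⇒coloop λ c cA≡0 → independent⇒vanishing {c = c} indB cA≡0 (λ i i∉B → ⊥-elim (i∉B (all∈B i))) x

corollary3p5 : (k m n : ℕ) (A : Matrix₃ m n) (r : ℕ) → IsRank A r →
    Simple A → NoColoops A → Paving A r k →
    IsCircuitMatroid A ⊎ r ≤ 4 * k + 2
corollary3p5 k m n A r rank _ noColoops paving with basis-of-rank A rank
... | B , basis , ∣B∣≡r with complement-trichotomy B
...   | inj₁ (e , f , e∉B , f∉B , e≢f) =
        inj₂ (two-outside-basis⇒rank≤ A {k = k} paving basis ∣B∣≡r e∉B f∉B e≢f)
...   | inj₂ (inj₁ (e , e∉B , only-e)) =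
        inj₁ (one-outside-basis⇒circuit A noColoops basis e∉B only-e)
...   | inj₂ (inj₂ all∈B) =
        inj₂ (subst (_≤ 4 * k + 2) (trans (sym ∣B∣≡0) ∣B∣≡r) z≤n)
  where
  ∣B∣≡0 : ∣ B ∣ ≡ 0
  ∣B∣≡0 = ∣p∣≡0 B λ x → noColoops x (independent-ground-set⇒coloop A (proj₁ basis) all∈B x)
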